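{- Let $(P_3,\sigma)$ be a signed path $xyz$ and let $L$ be a list assignment satisfying one of the following: (1) $L(y)=C$, $L(x)=\{c_x\}$ and $L(z)=\{c_z\}$ where $c_x$ and $c_z$ lie in different layers; (2) $L(y)$ is a paired $10$-set, $L(x)=\{c_x\}$ and $L(z)$ is a neighbored $5$-set; (3) $|L(y)|\ge 5$ and each of $L(x)$ and $L(z)$ is a neighbored $5$-set. Then $(P_3,\sigma)$ is $L$-colorable.
   Context: A signed graph is a simple graph with a signature $\sigma:E\to\{+,-\}$. Let $C=\{i^+,i^-:1\le i\le 6\}$ be the vertex set of ${\rm DSG}(K_6,M)$ with signature $m^*$: for $i\ne j$ and $\alpha\in\{+,-\}$, $i^\alpha j^\alpha$ is an edge, negative if $\{i,j\}\in\{\{1,2\},\{3,4\},\{5,6\}\}$ and positive otherwise; $i^\alpha j^{ -\alpha}$ is an edge, positive if $\{i,j\}\in\{\{1,2\},\{3,4\},\{5,6\}\}$ and negative otherwise; $i^+,i^-$ are non-adjacent. $C^\pm=\{i^\pm\}$. The pair of $(2l-1)^\alpha$ is $(2l)^\alpha$ and vice versa; a layer is a set $\{(2l-1)^+,(2l)^+,(2l-1)^-,(2l)^-\}$, $l=1,2,3$. $L\subseteq C$ is paired if all but at most one of its elements have their pair in $L$; a paired $n$-set is a paired set of size $n$. A paired set is layered if no three elements lie in one layer. A neighbored $5$-set is a layered set of size $5$ consisting of two pairs contained in one of $C^+,C^-$ and one element of the other. A list assignment $L$ gives each vertex $v$ a set $L(v)\subseteq C$; an $L$-coloring is a map $\phi$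 with $\phi(v)\in L(v)$ such that for every edge $uv$, $\phi(u)\phi(v)$ is an edge of ${\rm DSG}(K_6,M)$ with $m^*(\phi(u)\phi(v))=\sigma(uv)$. -}

module Defs where

open import Data.Bool using (Bool; true; false; _∧_; not; if_then_else_)
open import Data.Fin using (Fin; zero; suc)
import Data.Fin as F
open import Data.Nat using (ℕ; _≤_)
open import Data.List using (List; _∷_; []; length; filterᵇ; map; concatMap)
open import Data.Product using (_×_; _,_; proj₁; proj₂; Σ; Σ-syntax)
open import Data.Sum using (_⊎_)
open import Relation.Binary.PropositionalEquality using (_≡_; _≢_)
open import Relation.Nullary.Decidable using (⌊_⌋)
open import Function.Bundles using (_⇔_)

-- Signs: true = + , false = -
Sign : Set
Sign = Bool

-- Colors of DSG(K_6,M): i^α with i ∈ {1..6} encoded as Fin 6 (0-based), α a sign.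
Color : Set
Color = Fin 6 × Sign

idx : Color → Fin 6
idx = proj₁

sgn : Color → Sign
sgn = proj₂

allIdx : List (Fin 6)
allIdx = zero ∷ suc zero ∷ suc (suc zero) ∷ suc (suc (suc zero))
       ∷ suc (suc (suc (suc zero))) ∷ suc (suc (suc (suc (suc zero)))) ∷ []

allColors : List Color
allColors = concatMap (λ i → (i , true) ∷ (i , false) ∷ []) allIdx

-- partner index in the perfect matching M = {12,34,56} (0-based: 0-1,2-3,4-5)
pairIdx : Fin 6 → Fin 6
pairIdx zero = suc zero
pairIdx (suc zero) = zero
pairIdx (suc (suc zero)) = suc (suc (suc zero))
pairIdx (suc (suc (suc zero))) = suc (suc zero)
pairIdx (suc (suc (suc (suc zero)))) = suc (suc (suc (suc (suc zero))))
pairIdx (suc (suc (suc (suc (suc zero))))) = suc (suc (suc (suc zero)))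

inM : Fin 6 → Fin 6 → Bool
inM i j = ⌊ j F.≟ pairIdx i ⌋

pair : Color → Color
pair (i , α) = (pairIdx i , α)

-- layer index l ∈ {1,2,3} (0-based)
layer : Fin 6 → Fin 3
layer zero = zero
layer (suc zero) = zero
layer (suc (suc zero)) = suc zero
layer (suc (suc (suc zero))) = suc zero
layer (suc (suc (suc (suc zero)))) = suc (suc zero)
layer (suc (suc (suc (suc (suc zero))))) = suc (suc zero)

sameSign : Sign → Sign → Bool
sameSign true true = true
sameSign false false = true
sameSign _ _ = false

DSGEdge : Color → Color → Set
DSGEdge c d = idx c ≢ idx d

mstar : Color → Color → Sign
mstar (i , α) (j , β) =
  if sameSign α β
  then (if inM i j then false else true)
  else (if inM i j then true else false)

CSet : Set
CSet = Color → Bool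

_∈C_ : Color → CSet → Set
c ∈C S = S c ≡ true

size : CSet → ℕ
size S = length (filterᵇ S allColors)

fullC : CSet
fullC _ = true

IsSingleton : CSet → Color → Set
IsSingleton S c = ∀ d → (d ∈C S) ⇔ (d ≡ c)

Paired : CSet → Set
Paired S = length (filterᵇ (λ c → S c ∧ not (S (pair c))) allColors) ≤ 1

Layered : CSet → Set
Layered S = Paired S ×
  (∀ (l : Fin 3) → length (filterᵇ (λ c → S c ∧ ⌊ layer (idx c) F.≟ l ⌋) allColors) ≤ 2)

Neighbored5 : CSet → Set
Neighbored5 S = Layered S × size S ≡ 5 ×
  Σ[ α ∈ Sign ] Σ[ i ∈ Fin 6 ] Σ[ j ∈ Fin 6 ] Σ[ k ∈ Fin 6 ]
    (∀ c → (c ∈C S) ⇔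
       (c ≡ (i , α) ⊎ c ≡ pair (i , α) ⊎ c ≡ (j , α) ⊎ c ≡ pair (j , α) ⊎ c ≡ (k , not α)))

-- the signed path xyz with σ(xy) = σxy, σ(yz) = σyz; L-coloring with L(x)=Lx, L(y)=Ly, L(z)=Lz
Compatible : Color → Color → Sign → Set
Compatible c d s = DSGEdge c d × mstar c d ≡ s

P3Colorable : (σxy σyz : Sign) (Lx Ly Lz : CSet) → Set
P3Colorable σxy σyz Lx Ly Lz =
  Σ[ φx ∈ Color ] Σ[ φy ∈ Color ] Σ[ φz ∈ Color ]
    (φx ∈C Lx × φy ∈C Ly × φz ∈C Lz ×
     Compatible φx φy σxy × Compatible φy φz σyz)

-- A colour has exactly five neighbours of each sign in DSG(K₆,M), so a
-- single colour forbids at most 7 colours for a neighbour, while two pairs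
-- of one sign taken from distinct layers leave at most 2 colours without a
-- neighbour of a prescribed sign among them; a neighbored 5-set contains
-- such two pairs.  Hence in cases (2) and (3) some colour of L(y) survives
-- by counting (10 > 7 + 2 and 5 > 2 + 2); case (1) is a finite check.
module Submission where

open import Defs
open import Data.Nat using (_≥_)
open import Data.Fin using (Fin)
open import Data.Product using (_×_; Σ-syntax)
open import Data.Sum using (_⊎_)
open import Relation.Binary.PropositionalEquality using (_≡_; _≢_)

open import Data.Bool using (true; false; not; T)
import Data.Bool as Bool
open import Data.Bool.Properties using (T-≡)
import Data.Fin as F
open import Data.Fin.Properties using (all?)
open import Data.Nat using (ℕ; _+_; _≤_; _<_; _≤?_; z≤n; s≤s; s<s⁻¹)
open import Data.Nat.Properties
  using (≤-trans; ≤-reflexive; ≤-<-trans; <⇒≤; +-suc; +-mono-≤; m≤n⇒m≤1+n; n<1+n)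
open import Data.List using (List; []; _∷_; _∷ʳ_; length; filter)
open import Data.List.Membership.Propositional.Properties using (∈-++⁺ˡ)
open import Data.List.Relation.Unary.Any using (Any; here; there; any?; satisfied)
open import Data.List.Relation.Binary.Sublist.Propositional using (⊆-refl)
open import Data.List.Relation.Binary.Sublist.Propositional.Properties using (filter⁺; length-mono-≤)
open import Data.Product using (∃; _,_)
open import Data.Product.Properties using (≡-dec)
open import Data.Sum using (inj₁; inj₂)
open import Function using (_∘_; _⇔_; mk⇔; Equivalence)
open import Level using (Level)
open import Relation.Binary.Definitions using (DecidableEquality)
open import Relation.Binary.PropositionalEquality using (refl; sym; trans; subst)
open import Relation.Nullary using (¬_; Dec; yes; no; ¬?; _×-dec_; _→-dec_; map′; from-yes; T?)
open import Relation.Unary using (Pred; Decidable)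

private
  variable
    a p q r : Level
    A : Set a

misses : {P : Pred A p} → Decidable P → List A → ℕ
misses P? xs = length (filter (¬? ∘ P?) xs)

misses-× : {P : Pred A p} {Q : Pred A q} (P? : Decidable P) (Q? : Decidable Q) (xs : List A) →
  misses (λ x → P? x ×-dec Q? x) xs ≤ misses P? xs + misses Q? xs
misses-× P? Q? [] = z≤n
misses-× P? Q? (x ∷ xs) with ih ← misses-× P? Q? xs | P? x | Q? x
... | yes _ | yes _ = ih
... | yes _ | no _  = ≤-trans (s≤s ih) (≤-reflexive (sym (+-suc _ _)))
... | no _  | yes _ = s≤s ih
... | no _  | no _  = s≤s (≤-trans (m≤n⇒m≤1+n ih) (≤-reflexive (sym (+-suc _ _))))

pigeonhole : {P : Pred A p} {Q : Pred A q} (P? : Decidable P) (Q? : Decidable Q) (xs : List A) →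
  misses Q? xs < length (filter P? xs) → ∃ λ x → P x × Q x
pigeonhole P? Q? (x ∷ xs) lt with P? x | Q? x
... | yes px | yes qx = x , px , qx
... | yes _  | no _   = pigeonhole P? Q? xs (s<s⁻¹ lt)
... | no _   | yes _  = pigeonhole P? Q? xs lt
... | no _   | no _   = pigeonhole P? Q? xs (<⇒≤ lt)

pigeonhole₂ : {P : Pred A p} {Q : Pred A q} {R : Pred A r}
  (P? : Decidable P) (Q? : Decidable Q) (R? : Decidable R) (xs : List A) →
  misses Q? xs + misses R? xs < length (filter P? xs) → ∃ λ x → P x × Q x × R x
pigeonhole₂ P? Q? R? xs lt =
  pigeonhole P? (λ x → Q? x ×-dec R? x) xs (≤-<-trans (misses-× Q? R? xs) lt)

∀-Sign? : {P : Pred Sign p} → Decidable P → Dec (∀ s → P s)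
∀-Sign? P? = map′ (λ { (pt , pf) true → pt ; (pt , pf) false → pf }) (λ h → h true , h false)
                  (P? true ×-dec P? false)

∀-Color? : {P : Pred Color p} → Decidable P → Dec (∀ c → P c)
∀-Color? P? = map′ (λ h (i , α) → h i α) (λ h i α → h (i , α)) (all? λ i → ∀-Sign? λ α → P? (i , α))

_≟C_ : DecidableEquality Color
_≟C_ = ≡-dec F._≟_ Bool._≟_

open import Data.List.Membership.DecPropositional _≟C_ using (_∈_; _∈?_; find)

compatible? : ∀ c d s → Dec (Compatible c d s)
compatible? c d s = ¬? (idx c F.≟ idx d) ×-dec (mstar c d Bool.≟ s)

AdjacentTo : Sign → List Color → Color → Set
AdjacentTo s xs d = Any (λ x → Compatible d x s) xs

adjacentTo? : ∀ s xs → Decidable (AdjacentTo s xs)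
adjacentTo? s xs d = any? (λ x → compatible? d x s) xs

twoPairs : Sign → Fin 6 → Fin 6 → List Color
twoPairs α i j = (i , α) ∷ pair (i , α) ∷ (j , α) ∷ pair (j , α) ∷ []

neighboredShape : Sign → Fin 6 → Fin 6 → Fin 6 → List Color
neighboredShape α i j k = twoPairs α i j ∷ʳ (k , not α)

-- Exhaustive checks over the twelve colours.  They are opaque: unfolding
-- one at a use site would re-run the whole decision procedure.
opaque
  mstar-comm : ∀ c d → mstar c d ≡ mstar d c
  mstar-comm = from-yes (∀-Color? λ c → ∀-Color? λ d → mstar c d Bool.≟ mstar d c)

  misses-compatible≤7 : ∀ c s → misses (λ d → compatible? d c s) allColors ≤ 7
  misses-compatible≤7 = from-yes (∀-Color? λ c → ∀-Sign? λ s →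
    misses (λ d → compatible? d c s) allColors ≤? 7)

  common-neighbour : ∀ s₁ s₂ c₁ c₂ → layer (idx c₁) ≢ layer (idx c₂) →
    Any (λ d → Compatible d c₁ s₁ × Compatible d c₂ s₂) allColors
  common-neighbour = from-yes (∀-Sign? λ s₁ → ∀-Sign? λ s₂ → ∀-Color? λ c₁ → ∀-Color? λ c₂ →
    ¬? (layer (idx c₁) F.≟ layer (idx c₂)) →-dec
    any? (λ d → compatible? d c₁ s₁ ×-dec compatible? d c₂ s₂) allColors)

  misses-adjacentTo-twoPairs≤2 : ∀ s α i j → layer i ≢ layer j →
    misses (adjacentTo? s (twoPairs α i j)) allColors ≤ 2
  misses-adjacentTo-twoPairs≤2 = from-yes (∀-Sign? λ s → ∀-Sign? λ α → all? λ i → all? λ j →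
    ¬? (layer i F.≟ layer j) →-dec (misses (adjacentTo? s (twoPairs α i j)) allColors ≤? 2))

  -- Within one layer j is i or its pair, so the shape collapses to three colours.
  size-neighboredShape-sameLayer : ∀ α i j k → layer i ≡ layer j →
    length (filter (_∈? neighboredShape α i j k) allColors) ≤ 3
  size-neighboredShape-sameLayer = from-yes (∀-Sign? λ α → all? λ i → all? λ j → all? λ k →
    (layer i F.≟ layer j) →-dec (length (filter (_∈? neighboredShape α i j k) allColors) ≤? 3))

Compatible-sym : ∀ {c d s} → Compatible c d s → Compatible d c s
Compatible-sym {c} {d} (c≢d , m≡s) = c≢d ∘ sym , trans (mstar-comm d c) m≡s

∈-neighboredShape⇔ : ∀ {α i j k c} → c ∈ neighboredShape α i j k ⇔
  (c ≡ (i , α) ⊎ c ≡ pair (i , α) ⊎ c ≡ (j , α) ⊎ c ≡ pair (j , α) ⊎ c ≡ (k , not α))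
∈-neighboredShape⇔ = mk⇔
  (λ { (here e) → inj₁ e ; (there (here e)) → inj₂ (inj₁ e)
     ; (there (there (here e))) → inj₂ (inj₂ (inj₁ e))
     ; (there (there (there (here e)))) → inj₂ (inj₂ (inj₂ (inj₁ e)))
     ; (there (there (there (there (here e))))) → inj₂ (inj₂ (inj₂ (inj₂ e))) })
  (λ { (inj₁ e) → here e ; (inj₂ (inj₁ e)) → there (here e)
     ; (inj₂ (inj₂ (inj₁ e))) → there (there (here e))
     ; (inj₂ (inj₂ (inj₂ (inj₁ e)))) → there (there (there (here e)))
     ; (inj₂ (inj₂ (inj₂ (inj₂ e)))) → there (there (there (there (here e)))) })

record TwoPairsIn (S : CSet) : Set where
  field
    sign : Sign
    i j : Fin 6
    layers-distinct : layer i ≢ layer j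
    pairs⊆S : ∀ {c} → c ∈ twoPairs sign i j → c ∈C S

  pairs : List Color
  pairs = twoPairs sign i j

  neighbour : ∀ {s} d → AdjacentTo s pairs d → Σ[ x ∈ Color ] (x ∈C S × Compatible d x s)
  neighbour d d~pairs = let x , x∈ , d~x = find d~pairs in x , pairs⊆S x∈ , d~x

  misses-adjacentTo≤2 : ∀ s → misses (adjacentTo? s pairs) allColors ≤ 2
  misses-adjacentTo≤2 s = misses-adjacentTo-twoPairs≤2 s sign i j layers-distinct

open TwoPairsIn using (pairs; neighbour; misses-adjacentTo≤2)

Neighbored5⇒TwoPairsIn : ∀ {S} → Neighbored5 S → TwoPairsIn S
Neighbored5⇒TwoPairsIn {S} (_ , |S|≡5 , α , i , j , k , S⇔shape) = record
  { sign = α ; i = i ; j = j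
  ; layers-distinct = λ li≡lj → 5≰3 (subst (_≤ 3) |S|≡5 (≤-trans size-S≤shape
                                      (size-neighboredShape-sameLayer α i j k li≡lj)))
  ; pairs⊆S = λ c∈ → Equivalence.from (S⇔shape _) (Equivalence.to ∈-neighboredShape⇔ (∈-++⁺ˡ c∈))
  }
  where
  S⊆shape : ∀ {c} → T (S c) → c ∈ neighboredShape α i j k
  S⊆shape Sc = Equivalence.from ∈-neighboredShape⇔
    (Equivalence.to (S⇔shape _) (Equivalence.to T-≡ Sc))

  size-S≤shape : size S ≤ length (filter (_∈? neighboredShape α i j k) allColors)
  size-S≤shape = length-mono-≤
    (filter⁺ (T? ∘ S) (_∈? neighboredShape α i j k) (λ { refl → S⊆shape }) (⊆-refl {x = allColors}))

  5≰3 : ¬ 5 ≤ 3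
  5≰3 (s≤s (s≤s (s≤s ())))

∈-by-counting : ∀ {P : Pred Color p} {Q : Pred Color q} (S : CSet) (P? : Decidable P) (Q? : Decidable Q) →
  misses P? allColors + misses Q? allColors < size S → ∃ λ c → c ∈C S × P c × Q c
∈-by-counting S P? Q? lt with c , Sc , pc , qc ← pigeonhole₂ (T? ∘ S) P? Q? allColors lt =
  c , Equivalence.to T-≡ Sc , pc , qc

singleton∋ : ∀ {S c} → IsSingleton S c → c ∈C S
singleton∋ {c = c} S≡c = Equivalence.from (S≡c c) refl

colour-through : ∀ {σxy σyz Lx Ly Lz y} → y ∈C Ly →
  Σ[ x ∈ Color ] (x ∈C Lx × Compatible y x σxy) →
  Σ[ z ∈ Color ] (z ∈C Lz × Compatible y z σyz) →
  P3Colorable σxy σyz Lx Ly Lz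
colour-through {y = y} y∈Ly (x , x∈Lx , y~x) (z , z∈Lz , y~z) =
  x , y , z , x∈Lx , y∈Ly , z∈Lz , Compatible-sym {y} {x} y~x , y~z

lemma4p5 : (σxy σyz : Sign) (Lx Ly Lz : CSet) →
    ((∀ c → c ∈C Ly) ×
       (Σ[ cx ∈ Color ] Σ[ cz ∈ Color ]
          (IsSingleton Lx cx × IsSingleton Lz cz × layer (idx cx) ≢ layer (idx cz))))
    ⊎ ((Paired Ly × size Ly ≡ 10) × (Σ[ cx ∈ Color ] IsSingleton Lx cx) × Neighbored5 Lz)
    ⊎ (size Ly ≥ 5 × Neighbored5 Lx × Neighbored5 Lz) →
    P3Colorable σxy σyz Lx Ly Lz
lemma4p5 σxy σyz Lx Ly Lz (inj₁ (Ly-full , cx , cz , Lx≡cx , Lz≡cz , layers≢))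
  with y , y~cx , y~cz ← satisfied (common-neighbour σxy σyz cx cz layers≢) =
  colour-through (Ly-full y) (cx , singleton∋ Lx≡cx , y~cx) (cz , singleton∋ Lz≡cz , y~cz)
lemma4p5 σxy σyz Lx Ly Lz (inj₂ (inj₁ ((_ , |Ly|≡10) , (cx , Lx≡cx) , Lz-nb))) =
  let Z = Neighbored5⇒TwoPairsIn Lz-nb
      y , y∈Ly , y~cx , y~Z =
        ∈-by-counting Ly (λ y → compatible? y cx σxy) (adjacentTo? σyz (pairs Z))
          (≤-<-trans (+-mono-≤ (misses-compatible≤7 cx σxy) (misses-adjacentTo≤2 Z σyz))
                     (subst (9 <_) (sym |Ly|≡10) (n<1+n 9)))
  in colour-through y∈Ly (cx , singleton∋ Lx≡cx , y~cx) (neighbour Z y y~Z)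
lemma4p5 σxy σyz Lx Ly Lz (inj₂ (inj₂ (|Ly|≥5 , Lx-nb , Lz-nb))) =
  let X = Neighbored5⇒TwoPairsIn Lx-nb
      Z = Neighbored5⇒TwoPairsIn Lz-nb
      y , y∈Ly , y~X , y~Z =
        ∈-by-counting Ly (adjacentTo? σxy (pairs X)) (adjacentTo? σyz (pairs Z))
          (≤-<-trans (+-mono-≤ (misses-adjacentTo≤2 X σxy) (misses-adjacentTo≤2 Z σyz)) |Ly|≥5)
  in colour-through y∈Ly (neighbour X y y~X) (neighbour Z y y~Z)
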